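{- Let $G$ be a finite, simple, undirected, connected graph and $H$ an induced subgraph of $G$ such that, for all pairs of vertices $x,y$ of $H$, no shortest path in $G$ between $x$ and $y$ uses an edge of $G$ not belonging to $H$. Then for any set $S\subseteq V(G)$ containing an MEG-set of $H$, every edge of $H$ is monitored in $G$ by some pair of vertices of $S$.
   Context: Two vertices $x,y$ of a graph $F$ monitor an edge $e$ (in $F$) if $e$ belongs to all shortest paths between $x$ and $y$ in $F$; a set $S\subseteq V(F)$ is an MEG-set of $F$ if for every edge $e$ of $F$ some pair $x,y\in S$ monitors $e$ in $F$. -}

module Defs where

open import Data.Nat using (ℕ; suc; _≤_)
open import Data.Fin using (Fin)
open import Data.Fin.Subset using (Subset; _∈_)
open import Data.List using (List; []; _∷_; length)
open import Data.List.Membership.Propositional renaming (_∈_ to _∈ₗ_)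
open import Data.List.Relation.Unary.All using (All)
open import Data.Product using (_×_; _,_; ∃)
open import Data.Sum using (_⊎_)
open import Relation.Nullary using (¬_)
open import Relation.Binary using (Decidable)

record Graph (n : ℕ) : Set₁ where
  field
    Adj    : Fin n → Fin n → Set
    adj?   : Decidable Adj
    sym    : ∀ {x y} → Adj x y → Adj y x
    irrefl : ∀ {x} → ¬ Adj x x
open Graph public

module _ {n : ℕ} (G : Graph n) where

  data Walk : Fin n → Fin n → Set where
    nil  : ∀ {x} → Walk x x
    cons : ∀ {x y z} → Adj G x y → Walk y z → Walk x z

  len : ∀ {x y} → Walk x y → ℕ
  len nil = 0
  len (cons _ w) = suc (len w)

  verts : ∀ {x y} → Walk x y → List (Fin n)
  verts {x} nil = x ∷ []
  verts {x} (cons _ w) = x ∷ verts w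

  edges : ∀ {x y} → Walk x y → List (Fin n × Fin n)
  edges nil = []
  edges {x} (cons {y = y} _ w) = (x , y) ∷ edges w

  EdgeOn : Fin n → Fin n → ∀ {x y} → Walk x y → Set
  EdgeOn u v w = ((u , v) ∈ₗ edges w) ⊎ ((v , u) ∈ₗ edges w)

  Connected : Set
  Connected = ∀ x y → Walk x y

  -- shortest x-y walks (= shortest x-y paths) in G
  Shortest : ∀ {x y} → Walk x y → Set
  Shortest {x} {y} w = ∀ (w' : Walk x y) → len w ≤ len w'

  Monitors : Fin n → Fin n → Fin n → Fin n → Set
  Monitors x y u v = ∀ (w : Walk x y) → Shortest w → EdgeOn u v w

  -- The induced subgraph H = G[X] on vertex set X ⊆ V(G):
  -- its walks are exactly the walks of G staying inside X.
  module Induced (X : Subset n) where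

    HWalk : ∀ {x y} → Walk x y → Set
    HWalk w = All (_∈ X) (verts w)

    HEdge : Fin n → Fin n → Set
    HEdge u v = u ∈ X × v ∈ X × Adj G u v

    HShortest : ∀ {x y} → Walk x y → Set
    HShortest {x} {y} w = HWalk w × (∀ (w' : Walk x y) → HWalk w' → len w ≤ len w')

    HMonitors : Fin n → Fin n → Fin n → Fin n → Set
    HMonitors x y u v = ∀ (w : Walk x y) → HShortest w → EdgeOn u v w

    IsMEGSet : Subset n → Set
    IsMEGSet M = (∀ {z} → z ∈ M → z ∈ X) ×
      (∀ u v → HEdge u v → ∃ λ x → ∃ λ y → x ∈ M × y ∈ M × HMonitors x y u v)

    GeodesicallyClosed : Set
    GeodesicallyClosed = ∀ x y → x ∈ X → y ∈ X → (w : Walk x y) → Shortest w →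
      ∀ u v → (u , v) ∈ₗ edges w → u ∈ X × v ∈ X

{-# OPTIONS --safe #-}
module Submission where

open import Defs
open import Data.Nat using (ℕ)
open import Data.Fin using (Fin)
open import Data.Fin.Subset using (Subset; _∈_; _⊆_)
open import Data.Product using (_×_; ∃; _,_; proj₂)
open import Data.List.Relation.Unary.All using (All; _∷_; [])
open import Data.List.Relation.Unary.Any using (here; there)
open import Data.List.Membership.Propositional renaming (_∈_ to _∈ₗ_)
open import Relation.Binary.PropositionalEquality using (refl)

-- A shortest x–y walk of G cannot leave H, so it is already a shortest x–y walk
-- of H; hence every edge on all shortest x–y walks of H lies on all those of G.

module _ {n : ℕ} (G : Graph n) (X : Subset n) where
  open Induced G X

  edges⊆X⇒HWalk : ∀ {a b} (w : Walk G a b) → a ∈ X →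
    (∀ u v → (u , v) ∈ₗ edges G w → u ∈ X × v ∈ X) → HWalk w
  edges⊆X⇒HWalk nil a∈X _ = a∈X ∷ []
  edges⊆X⇒HWalk {a} (cons {y = y} _ w) a∈X edges⊆X =
    a∈X ∷ edges⊆X⇒HWalk w (proj₂ (edges⊆X a y (here refl)))
                          (λ u v uv∈w → edges⊆X u v (there uv∈w))

  Shortest⇒HShortest : GeodesicallyClosed → ∀ {x y} → x ∈ X → y ∈ X →
    (w : Walk G x y) → Shortest G w → HShortest w
  Shortest⇒HShortest closed x∈X y∈X w shortest =
    edges⊆X⇒HWalk w x∈X (closed _ _ x∈X y∈X w shortest) , λ w' _ → shortest w'

  HMonitors⇒Monitors : GeodesicallyClosed → ∀ {x y} → x ∈ X → y ∈ X →
    ∀ {u v} → HMonitors x y u v → Monitors G x y u v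
  HMonitors⇒Monitors closed x∈X y∈X monitorsH w shortest =
    monitorsH w (Shortest⇒HShortest closed x∈X y∈X w shortest)

lemma4 : ∀ {n} (G : Graph n) → Connected G → (X : Subset n) →
    Induced.GeodesicallyClosed G X →
    (S M : Subset n) → Induced.IsMEGSet G X M → M ⊆ S →
    ∀ u v → Induced.HEdge G X u v →
    ∃ λ x → ∃ λ y → x ∈ S × y ∈ S × Monitors G x y u v
lemma4 G _ X closed S M (M⊆X , megH) M⊆S u v uv∈H
  with megH u v uv∈H
... | x , y , x∈M , y∈M , monitorsH =
  x , y , M⊆S x∈M , M⊆S y∈M ,
  HMonitors⇒Monitors G X closed (M⊆X x∈M) (M⊆X y∈M) monitorsH
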